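{- Let $m,n$ be positive integers. Then $va^\equiv_1(K_{m,n})$ is given as follows, where $b$ and $c$ denote positive integers: (1) if $m=1$, then $va^\equiv_1(K_{1,n})=\lceil (n+2)/3\rceil$; (2) if $m=2$, then $va^\equiv_1(K_{2,n})=\lceil (n+3)/3\rceil$; (3) if $m=3b$ and $n=3c$, then $va^\equiv_1(K_{m,n})=p(b+c:m,n)$; (4) if $m=3b$ and $n=3c+1$, then $va^\equiv_1(K_{m,n})=p(b+c:m,n)$; (5) if $m=3b$ and $n=3c+2$, then $va^\equiv_1(K_{m,n})=p(b+c+1:m,n)$; (6) if $m=3b+1$ and $n=3c+1$, then $va^\equiv_1(K_{m,n})=p(b+c:m,n)$; (7) if $m=3b+1$ and $n=3c+2$, then $va^\equiv_1(K_{m,n})=b+c+2$; (8) if $m=3b+2$ and $n=3c+2$, then $va^\equiv_1(K_{m,n})=b+c+2$.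
   Context: All graphs are finite and simple. For a graph $G$ with $N=|V(G)|$ vertices, an equitable $q$-coloring of $G$ is a partition of $V(G)$ into $q$ (possibly empty) independent sets, each of size $\lfloor N/q\rfloor$ or $\lceil N/q\rceil$. An equitable $(q,r)$-tree-coloring of $G$ is a partition of $V(G)$ into $q$ sets (color classes), each of size $\lfloor N/q\rfloor$ or $\lceil N/q\rceil$, such that each set induces a forest of maximum degree at most $r$. The strong equitable vertex $r$-arboricity $va^\equiv_r(G)$ is the minimum $p$ such that $G$ has an equitable $(q,r)$-tree-coloring for every integer $q\ge p$. $K_{n_1,\ldots,n_k}$ is the complete $k$-partite graph with partite sets $X_1,\ldots,X_k$, $|X_i|=n_i$; $K_{m,n}$ is the complete bipartite graph with parts of sizes $m$ and $n$. Definition of $p$: suppose $K_{n_1,\ldots,n_k}$ has an equitable $q$-coloring. Then $p(q:n_1,\ldots,n_k)=\lceil n_1/d\rceil+\cdots+\lceil n_k/d\rceil$, where $d$ is the minimum integer with $d\ge\lceil (n_1+\cdots+n_k)/q\rceil$ satisfying at least one of: (i) there exist $i\ne j$ such that neither $n_i$ nor $n_j$ is divisible by $d$; (ii) there exists $i$ with $n_i/\lfloor n_i/d\rfloor>d+1$. -}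

module Defs where

open import Data.Nat using (ℕ; zero; suc; _+_; _*_; _∸_; _≤_; _<_; _<ᵇ_)
open import Data.Nat.DivMod using (_/_)
open import Data.Nat.Divisibility using (_∣_)
open import Data.Fin using (Fin; toℕ; inject₁; fromℕ; _≟_)
open import Data.Vec using (Vec; lookup; []; _∷_)
open import Data.Bool using (Bool; true; false; if_then_else_; _xor_; _∧_)
open import Data.Product using (Σ; _×_; ∃; ∃-syntax)
open import Data.Sum using (_⊎_)
open import Relation.Nullary using (¬_)
open import Relation.Nullary.Decidable using (⌊_⌋)
open import Relation.Binary.PropositionalEquality using (_≡_; refl)
open import Function.Definitions using (Injective)

-- ⌊ a / q ⌋, with the (irrelevant) convention ⌊ a / 0 ⌋ = 0.
floorDiv : ℕ → ℕ → ℕ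
floorDiv a zero    = 0
floorDiv a (suc q) = a / suc q

ceilDiv : ℕ → ℕ → ℕ
ceilDiv a q = floorDiv (a + q ∸ 1) q

countF : ∀ {N} → (Fin N → Bool) → ℕ
countF {zero}  f = 0
countF {suc N} f = (if f Fin.zero then 1 else 0) + countF (λ i → f (Fin.suc i))

record Graph : Set where
  field
    N      : ℕ
    adj    : Fin N → Fin N → Bool
    sym    : ∀ u v → adj u v ≡ adj v u
    irrefl : ∀ v → adj v v ≡ false
open Graph public

Subset : Graph → Set
Subset G = Fin (N G) → Bool

degIn : (G : Graph) → Subset G → Fin (N G) → ℕ
degIn G S v = countF (λ u → adj G v u ∧ S u)

IsCycleIn : (G : Graph) → Subset G → ∀ {k} → Vec (Fin (N G)) (suc (suc (suc k))) → Set
IsCycleIn G S {k} vs =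
  (∀ i → S (lookup vs i) ≡ true)
  × Injective _≡_ _≡_ (lookup vs)
  × (∀ (i : Fin (suc (suc k))) → adj G (lookup vs (inject₁ i)) (lookup vs (Fin.suc i)) ≡ true)
  × (adj G (lookup vs (fromℕ (suc (suc k)))) (lookup vs Fin.zero) ≡ true)

InducesForest : (G : Graph) → Subset G → Set
InducesForest G S = ∀ k (vs : Vec (Fin (N G)) (suc (suc (suc k)))) → ¬ IsCycleIn G S vs

colorClass : (G : Graph) {q : ℕ} → (Fin (N G) → Fin q) → Fin q → Subset G
colorClass G c i v = ⌊ c v ≟ i ⌋

-- G has an equitable (q,r)-tree-coloring: a partition of V(G) into q
-- (labelled, possibly empty) classes of size ⌊N/q⌋ or ⌈N/q⌉, each inducing
-- a forest of maximum degree at most r.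
HasEqTreeColoring : Graph → (q r : ℕ) → Set
HasEqTreeColoring G q r =
  Σ (Fin (N G) → Fin q) λ c →
    (∀ i → countF (colorClass G c i) ≡ floorDiv (N G) q
         ⊎ countF (colorClass G c i) ≡ ceilDiv (N G) q)
    × (∀ i → InducesForest G (colorClass G c i))
    × (∀ i v → colorClass G c i v ≡ true → degIn G (colorClass G c i) v ≤ r)

AllFrom : Graph → ℕ → ℕ → Set
AllFrom G r p = ∀ q → p ≤ q → HasEqTreeColoring G q r

IsStrongEqVertexArboricity : Graph → (r p : ℕ) → Set
IsStrongEqVertexArboricity G r p = AllFrom G r p × (∀ p' → AllFrom G r p' → p ≤ p')

-- Complete bipartite graph K_{m,n}: vertices 0..m-1 form X, m..m+n-1 form Y

inX : ∀ {m n} → Fin (m + n) → Bool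
inX {m} v = toℕ v <ᵇ m

private
  xor-sym : ∀ a b → a xor b ≡ b xor a
  xor-sym false false = refl
  xor-sym false true  = refl
  xor-sym true  false = refl
  xor-sym true  true  = refl

  xor-self : ∀ a → a xor a ≡ false
  xor-self false = refl
  xor-self true  = refl

K : ℕ → ℕ → Graph
K m n = record
  { N      = m + n
  ; adj    = λ u v → inX {m} {n} u xor inX {m} {n} v
  ; sym    = λ u v → xor-sym (inX {m} {n} u) (inX {m} {n} v)
  ; irrefl = λ v → xor-self (inX {m} {n} v)
  }

sumV : ∀ {k} → Vec ℕ k → ℕ
sumV []       = 0
sumV (x ∷ xs) = x + sumV xs

-- condition (i) or (ii) on d.  (ii) "n_i / ⌊n_i/d⌋ > d+1" is read after
-- clearing the denominator: n_i > (d+1)·⌊n_i/d⌋ (⌊n_i/d⌋ = 0 counts as ∞).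
DCond : ∀ {k} → Vec ℕ k → ℕ → Set
DCond {k} ns d =
  (∃[ i ] ∃[ j ] (¬ i ≡ j × ¬ (d ∣ lookup ns i) × ¬ (d ∣ lookup ns j)))
  ⊎ (∃[ i ] ((suc d) * floorDiv (lookup ns i) d < lookup ns i))

IsMinD : ∀ {k} → ℕ → Vec ℕ k → ℕ → Set
IsMinD q ns d =
  ceilDiv (sumV ns) q ≤ d × DCond ns d
  × (∀ d' → ceilDiv (sumV ns) q ≤ d' → DCond ns d' → d ≤ d')

sumCeil : ∀ {k} → Vec ℕ k → ℕ → ℕ
sumCeil []       d = 0
sumCeil (x ∷ xs) d = ceilDiv x d + sumCeil xs d

IsP : ∀ {k} → ℕ → Vec ℕ k → ℕ → Set
IsP q ns v = Σ ℕ λ d → IsMinD q ns d × v ≡ sumCeil ns d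

-- A colour class of K m n with a vertices in X and b in Y induces K a b, which has maximum degree at most 1
-- exactly when it lies inside one side or a = b = 1, and is then a forest.  So an equitable (q,1)-tree-colouring
-- is the same as a list of q such profiles (a , b) with column sums m and n and sizes ⌊N/q⌋ or ⌈N/q⌉.
--
-- Upper bounds: if ⌈m/(t+1)⌉ + ⌈n/(t+1)⌉ ≤ q ≤ ⌊m/t⌋ + ⌊n/t⌋, cut X and Y separately into parts of size t or
-- t + 1; sizes differing by at most one are automatically equitable.  Climbing t from 1, the single value
-- ⌊m/t⌋ + ⌊n/t⌋ + 1 left out at step t is reached from the previous step whenever t violates (i) and (ii)
-- of the definition of p, so every q ≥ ⌈m/d⌉ + ⌈n/d⌉ is attained.
--
-- Lower bounds: with q one below the claimed value, ⌊N/q⌋ ≥ 3, so every class lies inside X or inside Y, and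
-- comparing the part sizes with d (below, equal, above) contradicts the choice of d.  For m ≤ 2 no class of
-- size 3 fits into X, and for m, n ≡ 1, 2 mod 3 too few classes of size 3 fit into X and Y.

module Submission where

open import Defs hiding (sym)
open import Data.Bool using (Bool; true; false; _∧_; _xor_; if_then_else_)
open import Data.Empty using (⊥; ⊥-elim)
open import Data.Fin using (Fin; zero; suc; toℕ; fromℕ<; _↑ˡ_; _↑ʳ_; splitAt; _≟_)
open import Data.Fin.Properties using (toℕ<n; toℕ-↑ˡ; toℕ-↑ʳ; splitAt-↑ˡ; splitAt-↑ʳ; splitAt⁻¹-↑ˡ; splitAt⁻¹-↑ʳ)
open import Data.List using (List; []; _∷_; length; map; tabulate; lookup; _++_)
open import Data.List.Properties using (length-tabulate; tabulate-cong; map-tabulate; length-map; length-++; map-++)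
open import Data.List.Membership.Propositional using (_∈_)
open import Data.List.Membership.Propositional.Properties using (∈-lookup)
open import Data.List.Relation.Unary.All as All using (All; []; _∷_)
open import Data.List.Relation.Unary.All.Properties using (tabulate⁺; map⁺; map⁻; ++⁺)
open import Data.List.Relation.Unary.Any using (here; there)
open import Data.Nat
  using (ℕ; zero; suc; _+_; _*_; _∸_; _≤_; _<_; _≤′_; ≤′-refl; ≤′-step; _≤?_; _<?_; z≤n; s≤s; NonZero; >-nonZero; >-nonZero⁻¹)
open import Data.Nat.Properties hiding (_≟_)
open import Data.Nat.DivMod
  using (_/_; _%_; m≡m%n+[m/n]*n; m%n<n; m*n/n≡m; m/n*n≤m; /-monoˡ-≤; m<n*o⇒m/o<n; m<n⇒m/n≡0; n/1≡n)
open import Data.Nat.Divisibility using (_∣_; divides; _∣?_; 1∣_)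
open import Data.Nat.ListAction using (sum)
open import Data.Nat.ListAction.Properties using (sum-++)
open import Data.Nat.Tactic.RingSolver using (solve-∀)
open import Algebra.Properties.CommutativeSemigroup +-commutativeSemigroup using () renaming (interchange to +-interchange)
open import Data.Product using (Σ; ∃; ∃₂; _×_; _,_; proj₁; proj₂)
open import Data.Sum as Sum using (_⊎_; inj₁; inj₂; [_,_]′)
open import Data.Vec as Vec using (_∷_; [])
open import Function using (_∘_; _⇔_; mk⇔; Equivalence; case_of_)
open import Relation.Nullary using (¬_; Dec; yes; no; ¬?; _×-dec_; _⊎-dec_)
open import Relation.Nullary.Decidable using (⌊_⌋; dec-true; dec-false)
open import Relation.Binary.Definitions using (tri<; tri≈; tri>)
open import Relation.Binary.PropositionalEquality


ceilDiv-suc : ∀ x e → ceilDiv x (suc e) ≡ (x + e) / suc e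
ceilDiv-suc x e = cong (λ y → floorDiv (y ∸ 1) (suc e)) (+-suc x e)

floorDiv-*-≤ : ∀ x q → floorDiv x q * q ≤ x
floorDiv-*-≤ x zero    = z≤n
floorDiv-*-≤ x (suc e) = m/n*n≤m x (suc e)

floorDiv-greatest : ∀ {x} k q .{{_ : NonZero q}} → k * q ≤ x → k ≤ floorDiv x q
floorDiv-greatest {x} k q@(suc _) le = subst (_≤ x / q) (m*n/n≡m k q) (/-monoˡ-≤ q le)

<-suc-floorDiv-* : ∀ x q .{{_ : NonZero q}} → x < suc (floorDiv x q) * q
<-suc-floorDiv-* x q@(suc _) = begin-strict
  x                   ≡⟨ m≡m%n+[m/n]*n x q ⟩
  x % q + x / q * q   <⟨ +-monoˡ-< (x / q * q) (m%n<n x q) ⟩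
  q + x / q * q       ∎
  where open ≤-Reasoning

ceilDiv-least : ∀ {x} k q .{{_ : NonZero q}} → x ≤ k * q → ceilDiv x q ≤ k
ceilDiv-least {x} k q@(suc e) le rewrite ceilDiv-suc x e = ≤-pred (m<n*o⇒m/o<n (begin-strict
  x + e          ≤⟨ +-monoˡ-≤ e le ⟩
  k * q + e      <⟨ +-monoʳ-< (k * q) ≤-refl ⟩
  k * q + q      ≡⟨ +-comm (k * q) q ⟩
  suc k * q      ∎))
  where open ≤-Reasoning

≤-ceilDiv-* : ∀ x q .{{_ : NonZero q}} → x ≤ ceilDiv x q * q
≤-ceilDiv-* x q@(suc e) rewrite ceilDiv-suc x e = +-cancelʳ-≤ e x _ (≤-pred (begin-strict
  x + e                     <⟨ <-suc-floorDiv-* (x + e) q ⟩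
  q + (x + e) / q * q       ≡⟨ cong suc (+-comm e _) ⟩
  suc ((x + e) / q * q + e) ∎))
  where open ≤-Reasoning

floorDiv-unique : ∀ {x} k q .{{_ : NonZero q}} → k * q ≤ x → x < suc k * q → floorDiv x q ≡ k
floorDiv-unique {x} k q lo hi = ≤-antisym
  (≤-pred (*-cancelʳ-< q _ (suc k) (≤-<-trans (floorDiv-*-≤ x q) hi)))
  (floorDiv-greatest k q lo)

*-≤⇒≤-ceilDiv : ∀ {x} k q .{{_ : NonZero q}} → k * q ≤ x → k ≤ ceilDiv x q
*-≤⇒≤-ceilDiv {x} k q le = *-cancelʳ-≤ k _ q (≤-trans le (≤-ceilDiv-* x q))

*-<⇒<-ceilDiv : ∀ {x} k q .{{_ : NonZero q}} → k * q < x → k < ceilDiv x q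
*-<⇒<-ceilDiv {x} k q lt = *-cancelʳ-< q k _ (<-≤-trans lt (≤-ceilDiv-* x q))

<-ceilDiv⇒*-< : ∀ {x k} q .{{_ : NonZero q}} → k < ceilDiv x q → k * q < x
<-ceilDiv⇒*-< {x} {k} q k<⌈x/q⌉ = ≰⇒> λ x≤kq → <⇒≱ k<⌈x/q⌉ (ceilDiv-least k q x≤kq)

ceilDiv-unique : ∀ {x} k q .{{_ : NonZero q}} → k * q < x → x ≤ suc k * q → ceilDiv x q ≡ suc k
ceilDiv-unique k q lo hi = ≤-antisym (ceilDiv-least (suc k) q hi) (*-<⇒<-ceilDiv k q lo)

ceilDiv-exact : ∀ k q .{{_ : NonZero q}} → ceilDiv (k * q) q ≡ k
ceilDiv-exact k q = ≤-antisym (ceilDiv-least k q ≤-refl) (*-≤⇒≤-ceilDiv k q ≤-refl)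

floorDiv-+ : ∀ k q {r} .{{_ : NonZero q}} → r < q → floorDiv (k * q + r) q ≡ k
floorDiv-+ k q {r} r<q = floorDiv-unique k q (m≤m+n (k * q) r) (subst (k * q + r <_) (+-comm (k * q) q) (+-monoʳ-< (k * q) r<q))

ceilDiv-+ : ∀ k q {r} .{{_ : NonZero q}} → 0 < r → r ≤ q → ceilDiv (k * q + r) q ≡ suc k
ceilDiv-+ k q {r} 0<r r≤q =
  ceilDiv-unique k q (m<m+n (k * q) 0<r) (subst (k * q + r ≤_) (+-comm (k * q) q) (+-monoʳ-≤ (k * q) r≤q))

floorDiv≤ceilDiv : ∀ x q → floorDiv x q ≤ ceilDiv x q
floorDiv≤ceilDiv x zero      = z≤n
floorDiv≤ceilDiv x q@(suc _) = *-cancelʳ-≤ _ _ q (≤-trans (floorDiv-*-≤ x q) (≤-ceilDiv-* x q))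

ceilDiv≤suc-floorDiv : ∀ x q .{{_ : NonZero q}} → ceilDiv x q ≤ suc (floorDiv x q)
ceilDiv≤suc-floorDiv x q = ceilDiv-least _ q (<⇒≤ (<-suc-floorDiv-* x q))

∣⇒ceilDiv≤floorDiv : ∀ {x} q .{{_ : NonZero q}} → q ∣ x → ceilDiv x q ≤ floorDiv x q
∣⇒ceilDiv≤floorDiv q (divides k refl) = ≤-trans (ceilDiv-least k q ≤-refl) (floorDiv-greatest k q ≤-refl)

ceilDiv-antitone : ∀ x {q r} .{{_ : NonZero q}} .{{_ : NonZero r}} → q ≤ r → ceilDiv x r ≤ ceilDiv x q
ceilDiv-antitone x {q} {r} q≤r = ceilDiv-least _ r (≤-trans (≤-ceilDiv-* x q) (*-monoʳ-≤ (ceilDiv x q) q≤r))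

*-suc-≤⇒*-< : ∀ {x k d} → 1 ≤ x → k * suc d ≤ x → k * d < x
*-suc-≤⇒*-< {k = zero}      x≥1 _ = x≥1
*-suc-≤⇒*-< {k = suc k} {d} _   ≤x = <-≤-trans (*-monoʳ-< (suc k) (n<1+n d)) ≤x

countF-cong : ∀ {N} {f g : Fin N → Bool} → (∀ v → f v ≡ g v) → countF f ≡ countF g
countF-cong {zero}  f≗g = refl
countF-cong {suc N} f≗g = cong₂ _+_ (cong (λ b → if b then 1 else 0) (f≗g zero)) (countF-cong (f≗g ∘ suc))

countF-++ : ∀ m {n} (f : Fin (m + n) → Bool) → countF f ≡ countF (λ w → f (w ↑ˡ n)) + countF (λ w → f (m ↑ʳ w))
countF-++ zero    f = refl
countF-++ (suc m) {n} f = trans (cong ((if f zero then 1 else 0) +_) (countF-++ m {n} (f ∘ suc)))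
  (sym (+-assoc (if f zero then 1 else 0) _ _))

countF-false : ∀ {N} (f : Fin N → Bool) → (∀ v → f v ≡ false) → countF f ≡ 0
countF-false {zero}  f none = refl
countF-false {suc N} f none rewrite none zero = countF-false (f ∘ suc) (none ∘ suc)

countF-true : ∀ {N} (f : Fin N → Bool) → (∀ v → f v ≡ true) → countF f ≡ N
countF-true {zero}  f all = refl
countF-true {suc N} f all rewrite all zero = cong suc (countF-true (f ∘ suc) (all ∘ suc))

countF>0 : ∀ {N} (f : Fin N → Bool) v → f v ≡ true → 0 < countF f
countF>0 f zero    fv rewrite fv = s≤s z≤n
countF>0 f (suc v) fv = ≤-trans (countF>0 (f ∘ suc) v fv) (m≤n+m _ _)

countF≥2 : ∀ {N} (f : Fin N → Bool) u v → ¬ u ≡ v → f u ≡ true → f v ≡ true → 2 ≤ countF f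
countF≥2 f zero    zero    u≢v _  _  = ⊥-elim (u≢v refl)
countF≥2 f zero    (suc v) _   fu fv rewrite fu = s≤s (countF>0 (f ∘ suc) v fv)
countF≥2 f (suc u) zero    _   fu fv rewrite fv = s≤s (countF>0 (f ∘ suc) u fu)
countF≥2 f (suc u) (suc v) u≢v fu fv =
  ≤-trans (countF≥2 (f ∘ suc) u v (u≢v ∘ cong suc) fu fv) (m≤n+m _ (if f zero then 1 else 0))

countF≡0-or : ∀ {N} (f : Fin N → Bool) {P : Set} → (∀ v → f v ≡ true → P) → countF f ≡ 0 ⊎ P
countF≡0-or {zero}  f k = inj₁ refl
countF≡0-or {suc N} f k with f zero in f0
... | true  = inj₂ (k zero f0)
... | false = countF≡0-or (f ∘ suc) (k ∘ suc)

indicator : ∀ {q} → Fin q → Fin q → ℕ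
indicator x i = if ⌊ x ≟ i ⌋ then 1 else 0

≟-suc : ∀ {q} (x i : Fin q) → ⌊ suc x ≟ suc i ⌋ ≡ ⌊ x ≟ i ⌋
≟-suc x i with x ≟ i
... | yes _ = refl
... | no  _ = refl

indicator-suc : ∀ {q} (x i : Fin q) → indicator (suc x) (suc i) ≡ indicator x i
indicator-suc x i = cong (λ b → if b then 1 else 0) (≟-suc x i)

sum-tabulate-+ : ∀ {q} (g h : Fin q → ℕ) → sum (tabulate (λ i → g i + h i)) ≡ sum (tabulate g) + sum (tabulate h)
sum-tabulate-+ {zero}  g h = refl
sum-tabulate-+ {suc q} g h = trans (cong (g zero + h zero +_) (sum-tabulate-+ (g ∘ suc) (h ∘ suc)))
  (+-interchange (g zero) (h zero) _ _)

sum-tabulate-0 : ∀ {q} (g : Fin q → ℕ) → (∀ i → g i ≡ 0) → sum (tabulate g) ≡ 0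
sum-tabulate-0 {zero}  g g≡0 = refl
sum-tabulate-0 {suc q} g g≡0 rewrite g≡0 zero = sum-tabulate-0 (g ∘ suc) (g≡0 ∘ suc)

sum-tabulate-indicator : ∀ {q} (x : Fin q) → sum (tabulate (indicator x)) ≡ 1
sum-tabulate-indicator {suc q} zero = cong suc (sum-tabulate-0 {q} (indicator zero ∘ suc) λ _ → refl)
sum-tabulate-indicator (suc x) =
  trans (cong sum (tabulate-cong (indicator-suc x))) (sum-tabulate-indicator x)

sum-tabulate-countF : ∀ {N q} (f : Fin N → Fin q) → sum (tabulate (λ i → countF (λ v → ⌊ f v ≟ i ⌋))) ≡ N
sum-tabulate-countF {zero}  f = sum-tabulate-0 (λ i → countF (λ v → ⌊ f v ≟ i ⌋)) λ _ → refl
sum-tabulate-countF {suc N} f = trans (sum-tabulate-+ (indicator (f zero)) _)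
  (cong₂ _+_ (sum-tabulate-indicator (f zero)) (sum-tabulate-countF (f ∘ suc)))

blocks : ∀ {A : Set} (f : A → ℕ) (ℓ : List A) → Fin (sum (map f ℓ)) → Fin (length ℓ)
blocks f (x ∷ ℓ) v = [ (λ _ → zero) , suc ∘ blocks f ℓ ]′ (splitAt (f x) v)

countF-blocks : ∀ {A : Set} (f : A → ℕ) (ℓ : List A) i → countF (λ v → ⌊ blocks f ℓ v ≟ i ⌋) ≡ f (lookup ℓ i)
countF-blocks f (x ∷ ℓ) i =
  trans (countF-++ (f x) _) (trans (cong₂ _+_ (countF-cong first) (countF-cong rest)) (count i))
  where
  block : Fin (f x) ⊎ Fin (sum (map f ℓ)) → Fin (suc (length ℓ))
  block = [ (λ _ → zero) , suc ∘ blocks f ℓ ]′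
  first : ∀ w → ⌊ block (splitAt (f x) (w ↑ˡ sum (map f ℓ))) ≟ i ⌋ ≡ ⌊ zero ≟ i ⌋
  first w = cong (λ s → ⌊ block s ≟ i ⌋) (splitAt-↑ˡ (f x) w (sum (map f ℓ)))
  rest : ∀ w → ⌊ block (splitAt (f x) (f x ↑ʳ w)) ≟ i ⌋ ≡ ⌊ suc (blocks f ℓ w) ≟ i ⌋
  rest w = cong (λ s → ⌊ block s ≟ i ⌋) (splitAt-↑ʳ (f x) (sum (map f ℓ)) w)
  count : ∀ i → countF {f x} (λ _ → ⌊ zero ≟ i ⌋) + countF (λ w → ⌊ suc (blocks f ℓ w) ≟ i ⌋)
              ≡ f (lookup (x ∷ ℓ) i)
  count zero    = trans (cong₂ _+_ (countF-true {f x} _ λ _ → refl)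
                                   (countF-false (λ w → ⌊ suc (blocks f ℓ w) ≟ zero ⌋) λ _ → refl))
                        (+-identityʳ (f x))
  count (suc i) = cong₂ _+_ (countF-false {f x} _ λ _ → refl)
                            (trans (countF-cong λ w → ≟-suc (blocks f ℓ w) i) (countF-blocks f ℓ i))

-- a cycle v₀ v₁ v₂ … makes v₁ adjacent to the distinct vertices v₀ and v₂
maxDeg≤1⇒forest : ∀ G (S : Subset G) → (∀ v → S v ≡ true → degIn G S v ≤ 1) → InducesForest G S
maxDeg≤1⇒forest G S deg k vs (inS , injective , edges , _) = <⇒≱ deg[v₁]≥2 (deg v₁ (inS (suc zero)))
  where
  v₀ v₁ v₂ : Fin (N G)
  v₀ = Vec.lookup vs zero
  v₁ = Vec.lookup vs (suc zero)
  v₂ = Vec.lookup vs (suc (suc zero))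
  deg[v₁]≥2 : 2 ≤ degIn G S v₁
  deg[v₁]≥2 = countF≥2 _ v₀ v₂ (λ v₀≡v₂ → case injective v₀≡v₂ of λ ())
    (cong₂ _∧_ (trans (Graph.sym G v₁ v₀) (edges zero)) (inS zero))
    (cong₂ _∧_ (edges (suc zero)) (inS (suc (suc zero))))

inX-↑ˡ : ∀ {m n} (w : Fin m) → inX {m} {n} (w ↑ˡ n) ≡ true
inX-↑ˡ {m} {n} w = dec-true (toℕ (w ↑ˡ n) <? m) (subst (_< m) (sym (toℕ-↑ˡ w n)) (toℕ<n w))

inX-↑ʳ : ∀ {m n} (w : Fin n) → inX {m} {n} (m ↑ʳ w) ≡ false
inX-↑ʳ {m} {n} w = dec-false (toℕ (m ↑ʳ w) <? m) (≤⇒≯ (subst (m ≤_) (sym (toℕ-↑ʳ m w)) (m≤m+n m (toℕ w))))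

module _ {m n : ℕ} (S : Subset (K m n)) where

  private
    edge : Fin (m + n) → Fin (m + n) → Bool
    edge v u = adj (K m n) v u ∧ S u

  degIn-↑ˡ : ∀ w → degIn (K m n) S (w ↑ˡ n) ≡ countF (λ u → S (m ↑ʳ u))
  degIn-↑ˡ w = trans (countF-++ m (edge (w ↑ˡ n)))
    (cong₂ _+_ (countF-false _ λ u → cong₂ (λ a b → (a xor b) ∧ S (u ↑ˡ n)) (inX-↑ˡ {m} {n} w) (inX-↑ˡ {m} {n} u))
               (countF-cong λ u → cong₂ (λ a b → (a xor b) ∧ S (m ↑ʳ u)) (inX-↑ˡ {m} {n} w) (inX-↑ʳ {m} {n} u)))

  degIn-↑ʳ : ∀ w → degIn (K m n) S (m ↑ʳ w) ≡ countF (λ u → S (u ↑ˡ n))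
  degIn-↑ʳ w = trans (countF-++ m (edge (m ↑ʳ w)))
    (trans (cong₂ _+_ (countF-cong λ u → cong₂ (λ a b → (a xor b) ∧ S (u ↑ˡ n)) (inX-↑ʳ {m} {n} w) (inX-↑ˡ {m} {n} u))
                      (countF-false _ λ u → cong₂ (λ a b → (a xor b) ∧ S (m ↑ʳ u)) (inX-↑ʳ {m} {n} w) (inX-↑ʳ {m} {n} u)))
           (+-identityʳ _))

↑ˡ-or-↑ʳ : ∀ m {n} (v : Fin (m + n)) → (∃ λ w → w ↑ˡ n ≡ v) ⊎ (∃ λ w → m ↑ʳ w ≡ v)
↑ˡ-or-↑ʳ m v with splitAt m v in eq
... | inj₁ w = inj₁ (w , splitAt⁻¹-↑ˡ eq)
... | inj₂ w = inj₂ (w , splitAt⁻¹-↑ʳ eq)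

-- A colour class of K m n is recorded by its numbers (a , b) of vertices in X and in Y; it induces K a b.
size : ℕ × ℕ → ℕ
size p = proj₁ p + proj₂ p

MaxDeg≤1 : ℕ × ℕ → Set
MaxDeg≤1 p = (proj₁ p ≡ 0 ⊎ proj₂ p ≤ 1) × (proj₂ p ≡ 0 ⊎ proj₁ p ≤ 1)

EquitableSize : ℕ → ℕ → ℕ × ℕ → Set
EquitableSize N q p = size p ≡ floorDiv N q ⊎ size p ≡ ceilDiv N q

record Plan (m n q : ℕ) : Set where
  field
    classes   : List (ℕ × ℕ)
    length≡q  : length classes ≡ q
    sumX≡m    : sum (map proj₁ classes) ≡ m
    sumY≡n    : sum (map proj₂ classes) ≡ n
    equitable : All (EquitableSize (m + n) q) classes
    maxDeg≤1  : All MaxDeg≤1 classes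

subst-coloring : ∀ {m m′ n n′ q q′ r} → m ≡ m′ → n ≡ n′ → q ≡ q′ →
  HasEqTreeColoring (K m n) q r → HasEqTreeColoring (K m′ n′) q′ r
subst-coloring refl refl refl coloring = coloring

other-side≤1 : ∀ {a b} → a ≡ 0 ⊎ b ≤ 1 → 0 < a → b ≤ 1
other-side≤1 (inj₁ refl) ()
other-side≤1 (inj₂ b≤1) _ = b≤1

coloring⇒plan : ∀ {m n q} → HasEqTreeColoring (K m n) q 1 → Plan m n q
coloring⇒plan {m} {n} {q} (c , equitable , _ , deg≤1) = record
  { classes   = tabulate profile
  ; length≡q  = length-tabulate profile
  ; sumX≡m    = trans (cong sum (map-tabulate profile proj₁)) (sum-tabulate-countF (λ w → c (w ↑ˡ n)))
  ; sumY≡n    = trans (cong sum (map-tabulate profile proj₂)) (sum-tabulate-countF (λ w → c (m ↑ʳ w)))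
  ; equitable = tabulate⁺ λ i → Sum.map (trans (sym (countF-++ m _))) (trans (sym (countF-++ m _))) (equitable i)
  ; maxDeg≤1  = tabulate⁺ λ i →
      countF≡0-or _ (λ w cw → subst (_≤ 1) (degIn-↑ˡ (class i) w) (deg≤1 i (w ↑ˡ n) cw)) ,
      countF≡0-or _ (λ w cw → subst (_≤ 1) (degIn-↑ʳ (class i) w) (deg≤1 i (m ↑ʳ w) cw))
  }
  where
  class : Fin q → Subset (K m n)
  class = colorClass (K m n) c
  profile : Fin q → ℕ × ℕ
  profile i = countF (λ w → class i (w ↑ˡ n)) , countF (λ w → class i (m ↑ʳ w))

plan⇒coloring : ∀ {m n q} → Plan m n q → HasEqTreeColoring (K m n) q 1
plan⇒coloring record { classes = ℓ ; length≡q = refl ; sumX≡m = refl ; sumY≡n = refl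
                     ; equitable = equitable ; maxDeg≤1 = maxDeg≤1 } =
  c , equitable-c , (λ i → maxDeg≤1⇒forest (K m n) (class i) (deg≤1 i)) , deg≤1
  where
  m n : ℕ
  m = sum (map proj₁ ℓ)
  n = sum (map proj₂ ℓ)
  c : Fin (m + n) → Fin (length ℓ)
  c v = [ blocks proj₁ ℓ , blocks proj₂ ℓ ]′ (splitAt m v)
  class : Fin (length ℓ) → Subset (K m n)
  class = colorClass (K m n) c
  countX : ∀ i → countF (λ w → class i (w ↑ˡ n)) ≡ proj₁ (lookup ℓ i)
  countX i = trans (countF-cong λ w → cong (λ s → ⌊ [ blocks proj₁ ℓ , blocks proj₂ ℓ ]′ s ≟ i ⌋) (splitAt-↑ˡ m w n))
                   (countF-blocks proj₁ ℓ i)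
  countY : ∀ i → countF (λ w → class i (m ↑ʳ w)) ≡ proj₂ (lookup ℓ i)
  countY i = trans (countF-cong λ w → cong (λ s → ⌊ [ blocks proj₁ ℓ , blocks proj₂ ℓ ]′ s ≟ i ⌋) (splitAt-↑ʳ m n w))
                   (countF-blocks proj₂ ℓ i)
  equitable-c : ∀ i → countF (class i) ≡ floorDiv (m + n) (length ℓ) ⊎ countF (class i) ≡ ceilDiv (m + n) (length ℓ)
  equitable-c i = Sum.map (trans size-i) (trans size-i) (All.lookup equitable (∈-lookup i))
    where
    size-i : countF (class i) ≡ size (lookup ℓ i)
    size-i = trans (countF-++ m _) (cong₂ _+_ (countX i) (countY i))
  deg≤1 : ∀ i v → class i v ≡ true → degIn (K m n) (class i) v ≤ 1
  deg≤1 i v cv with ↑ˡ-or-↑ʳ m v | All.lookup maxDeg≤1 (∈-lookup i)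
  ... | inj₁ (w , refl) | x≡0-or-y≤1 , _ = subst (_≤ 1) (sym (trans (degIn-↑ˡ (class i) w) (countY i)))
        (other-side≤1 x≡0-or-y≤1 (subst (0 <_) (countX i) (countF>0 _ w cv)))
  ... | inj₂ (w , refl) | _ , y≡0-or-x≤1 = subst (_≤ 1) (sym (trans (degIn-↑ʳ (class i) w) (countX i)))
        (other-side≤1 y≡0-or-x≤1 (subst (0 <_) (countY i) (countF>0 _ w cv)))

Near : ℕ → ℕ → Set
Near t s = s ≡ t ⊎ s ≡ suc t

near⇒≥ : ∀ {t s} → Near t s → t ≤ s
near⇒≥ (inj₁ refl) = ≤-refl
near⇒≥ (inj₂ refl) = n≤1+n _

near⇒≤ : ∀ {t s} → Near t s → s ≤ suc t
near⇒≤ (inj₁ refl) = n≤1+n _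
near⇒≤ (inj₂ refl) = ≤-refl

module _ {t : ℕ} where
  open ≤-Reasoning

  sum-near-≥ : ∀ {xs} → All (Near t) xs → t * length xs ≤ sum xs
  sum-near-≥ []                      = ≤-reflexive (*-zeroʳ t)
  sum-near-≥ {x ∷ xs} (near ∷ nears) = begin
    t * suc (length xs) ≡⟨ *-suc t (length xs) ⟩
    t + t * length xs   ≤⟨ +-mono-≤ (near⇒≥ near) (sum-near-≥ nears) ⟩
    x + sum xs          ∎

  sum-near-≤ : ∀ {xs} → All (Near t) xs → sum xs ≤ suc t * length xs
  sum-near-≤ []                      = ≤-reflexive (sym (*-zeroʳ t))
  sum-near-≤ {x ∷ xs} (near ∷ nears) = begin
    x + sum xs                ≤⟨ +-mono-≤ (near⇒≤ near) (sum-near-≤ nears) ⟩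
    suc t + suc t * length xs ≡⟨ *-suc (suc t) (length xs) ⟨
    suc t * suc (length xs)   ∎

  sum-near-< : ∀ {x xs} → x ∈ xs → All (Near t) xs → x ≡ t → sum xs < suc t * length xs
  sum-near-< {xs = x ∷ xs} (here refl) (_ ∷ nears) refl = begin-strict
    x + sum xs                ≤⟨ +-monoʳ-≤ x (sum-near-≤ nears) ⟩
    x + suc t * length xs     <⟨ +-monoˡ-< _ (n<1+n x) ⟩
    suc t + suc t * length xs ≡⟨ *-suc (suc t) (length xs) ⟨
    suc t * suc (length xs)   ∎
  sum-near-< {xs = y ∷ xs} (there x∈) (near ∷ nears) x≡t = begin-strict
    y + sum xs                ≡⟨ +-comm y _ ⟩
    sum xs + y                <⟨ +-mono-<-≤ (sum-near-< x∈ nears x≡t) (near⇒≤ near) ⟩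
    suc t * length xs + suc t ≡⟨ +-comm _ (suc t) ⟩
    suc t + suc t * length xs ≡⟨ *-suc (suc t) (length xs) ⟨
    suc t * suc (length xs)   ∎

  sum-near-> : ∀ {x xs} → x ∈ xs → All (Near t) xs → x ≡ suc t → t * length xs < sum xs
  sum-near-> {xs = x ∷ xs} (here refl) (_ ∷ nears) refl = begin-strict
    t * suc (length xs) ≡⟨ *-suc t (length xs) ⟩
    t + t * length xs   <⟨ +-mono-<-≤ (n<1+n t) (sum-near-≥ nears) ⟩
    suc t + sum xs      ∎
  sum-near-> {xs = y ∷ xs} (there x∈) (near ∷ nears) x≡1+t = begin-strict
    t * suc (length xs) ≡⟨ *-suc t (length xs) ⟩
    t + t * length xs   <⟨ +-mono-≤-< (near⇒≥ near) (sum-near-> x∈ nears x≡1+t) ⟩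
    y + sum xs          ∎

  near⇒equitable : ∀ xs → All (Near t) xs →
    All (λ x → x ≡ floorDiv (sum xs) (length xs) ⊎ x ≡ ceilDiv (sum xs) (length xs)) xs
  near⇒equitable []         []    = []
  near⇒equitable xs@(_ ∷ _) nears = All.tabulate λ {x} x∈ → case All.lookup nears x∈ of λ where
    (inj₁ x≡t)   → inj₁ (trans x≡t (sym (floorDiv-unique t (length xs) (sum-near-≥ nears) (sum-near-< x∈ nears x≡t))))
    (inj₂ x≡1+t) → inj₂ (trans x≡1+t (sym (ceilDiv-unique t (length xs) (sum-near-> x∈ nears x≡1+t) (sum-near-≤ nears))))

near-partition : ∀ k t x → k * t ≤ x → x ≤ k * suc t → ∃ λ xs → length xs ≡ k × sum xs ≡ x × All (Near t) xs
near-partition zero    t x _  x≤0 = [] , refl , sym (n≤0⇒n≡0 x≤0) , []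
near-partition (suc k) t x lo hi = first-part (x ≤? t + k * suc t)
  where
  part : ∀ a → Near t a → a + k * t ≤ x → x ∸ a ≤ k * suc t → ∃ λ xs → length xs ≡ suc k × sum xs ≡ x × All (Near t) xs
  part a near lo' hi'
    with near-partition k t (x ∸ a) (m+n≤o⇒m≤o∸n (k * t) (≤-trans (≤-reflexive (+-comm (k * t) a)) lo')) hi'
  ... | xs , length≡k , sum≡ , nears =
    a ∷ xs , cong suc length≡k , trans (cong (a +_) sum≡) (m+[n∸m]≡n (m+n≤o⇒m≤o a lo')) , near ∷ nears
  first-part : Dec (x ≤ t + k * suc t) → ∃ λ xs → length xs ≡ suc k × sum xs ≡ x × All (Near t) xs
  first-part (yes x≤) = part t (inj₁ refl) lo (m≤n+o⇒m∸n≤o x t x≤)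
  first-part (no  x≰) = part (suc t) (inj₂ refl) (≤-trans (+-monoʳ-≤ (suc t) (*-monoʳ-≤ k (n≤1+n t))) (≰⇒> x≰))
                             (m≤n+o⇒m∸n≤o x (suc t) hi)

sum-map-size : ∀ ℓ → sum (map size ℓ) ≡ sum (map proj₁ ℓ) + sum (map proj₂ ℓ)
sum-map-size []      = refl
sum-map-size (p ∷ ℓ) = trans (cong (size p +_) (sum-map-size ℓ)) (+-interchange (proj₁ p) (proj₂ p) _ _)

near⇒plan : ∀ t ℓ → All (Near t ∘ size) ℓ → All MaxDeg≤1 ℓ →
  Plan (sum (map proj₁ ℓ)) (sum (map proj₂ ℓ)) (length ℓ)
near⇒plan t ℓ nears maxDeg≤1 = record
  { classes   = ℓ
  ; length≡q  = refl
  ; sumX≡m    = refl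
  ; sumY≡n    = refl
  ; equitable = subst₂ (λ N q → All (EquitableSize N q) ℓ) (sum-map-size ℓ) (length-map size ℓ)
                       (map⁻ (near⇒equitable (map size ℓ) (map⁺ nears)))
  ; maxDeg≤1  = maxDeg≤1
  }

onlyX onlyY : List ℕ → List (ℕ × ℕ)
onlyX = map (_, 0)
onlyY = map (0 ,_)

sum-map-++ : ∀ {A : Set} (f : A → ℕ) xs ys → sum (map f (xs ++ ys)) ≡ sum (map f xs) + sum (map f ys)
sum-map-++ f xs ys = trans (cong sum (map-++ f xs ys)) (sum-++ (map f xs) (map f ys))

sumX-only : ∀ xs ys → sum (map proj₁ (onlyX xs ++ onlyY ys)) ≡ sum xs
sumX-only []       []       = refl
sumX-only []       (y ∷ ys) = sumX-only [] ys
sumX-only (x ∷ xs) ys       = cong (x +_) (sumX-only xs ys)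

sumY-only : ∀ xs ys → sum (map proj₂ (onlyX xs ++ onlyY ys)) ≡ sum ys
sumY-only []       []       = refl
sumY-only []       (y ∷ ys) = cong (y +_) (sumY-only [] ys)
sumY-only (x ∷ xs) ys       = sumY-only xs ys

-- q classes: the given classes ℓ₀, then kx classes inside X and ky inside Y, all of size t or t + 1.
near-coloring : ∀ t {kx ky mx ny m n q} ℓ₀ → All (Near t ∘ size) ℓ₀ → All MaxDeg≤1 ℓ₀ →
  kx * t ≤ mx → mx ≤ kx * suc t → ky * t ≤ ny → ny ≤ ky * suc t →
  sum (map proj₁ ℓ₀) + mx ≡ m → sum (map proj₂ ℓ₀) + ny ≡ n → length ℓ₀ + (kx + ky) ≡ q →
  HasEqTreeColoring (K m n) q 1
near-coloring t {kx} {ky} {mx} {ny} ℓ₀ nears₀ maxDeg₀ x-lo x-hi y-lo y-hi refl refl refl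
  with near-partition kx t mx x-lo x-hi | near-partition ky t ny y-lo y-hi
... | xs , refl , refl , xnears | ys , refl , refl , ynears =
  subst-coloring sumX sumY lengthℓ (plan⇒coloring (near⇒plan t ℓ nears maxDeg≤1))
  where
  ℓ : List (ℕ × ℕ)
  ℓ = ℓ₀ ++ onlyX xs ++ onlyY ys
  nears : All (Near t ∘ size) ℓ
  nears = ++⁺ nears₀ (++⁺ (map⁺ (All.map (subst (Near t) (sym (+-identityʳ _))) xnears)) (map⁺ ynears))
  maxDeg≤1 : All MaxDeg≤1 ℓ
  maxDeg≤1 = ++⁺ maxDeg₀ (++⁺ (map⁺ (All.universal (λ _ → inj₂ z≤n , inj₁ refl) xs))
                              (map⁺ (All.universal (λ _ → inj₁ refl , inj₂ z≤n) ys)))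
  sumX : sum (map proj₁ ℓ) ≡ sum (map proj₁ ℓ₀) + sum xs
  sumX = trans (sum-map-++ proj₁ ℓ₀ _) (cong (sum (map proj₁ ℓ₀) +_) (sumX-only xs ys))
  sumY : sum (map proj₂ ℓ) ≡ sum (map proj₂ ℓ₀) + sum ys
  sumY = trans (sum-map-++ proj₂ ℓ₀ _) (cong (sum (map proj₂ ℓ₀) +_) (sumY-only xs ys))
  lengthℓ : length ℓ ≡ length ℓ₀ + (length xs + length ys)
  lengthℓ = trans (length-++ ℓ₀) (cong (length ℓ₀ +_)
              (trans (length-++ (onlyX xs)) (cong₂ _+_ (length-map _ xs) (length-map _ ys))))

-- Upper bounds

ceilSum : ℕ → ℕ → ℕ → ℕ
ceilSum m n d = ceilDiv m d + ceilDiv n d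

split-between : ∀ {a₀ a b₀ b q} → a₀ ≤ a → b₀ ≤ b → a₀ + b₀ ≤ q → q ≤ a + b →
  ∃₂ λ x y → x + y ≡ q × a₀ ≤ x × x ≤ a × b₀ ≤ y × y ≤ b
split-between {a₀} {a} {b₀} {b} {q} a₀≤a b₀≤b lo hi with q ≤? a + b₀
... | yes q≤a+b₀ = q ∸ b₀ , b₀ , m∸n+n≡m (m+n≤o⇒n≤o a₀ lo) ,
                   m+n≤o⇒m≤o∸n a₀ lo , m≤n+o⇒m∸n≤o q b₀ (subst (q ≤_) (+-comm a b₀) q≤a+b₀) , ≤-refl , b₀≤b
... | no  q≰a+b₀ = a , q ∸ a , m+[n∸m]≡n (m+n≤o⇒m≤o a (<⇒≤ (≰⇒> q≰a+b₀))) ,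
                   a₀≤a , ≤-refl , m+n≤o⇒m≤o∸n b₀ (subst (_≤ q) (+-comm a b₀) (<⇒≤ (≰⇒> q≰a+b₀))) , m≤n+o⇒m∸n≤o q a hi

allFrom-1 : ∀ m n → AllFrom (K m n) 1 (ceilSum m n 1)
allFrom-1 m n q q≥ = near-coloring 0 {m} {q ∸ m} [] [] []
  (*0≤ m) (≤-reflexive (sym (*-identityʳ m))) (*0≤ (q ∸ m)) (≤-trans (n≤q∸m) (≤-reflexive (sym (*-identityʳ _))))
  refl refl (m+[n∸m]≡n (m+n≤o⇒m≤o m m+n≤q))
  where
  ceilDiv-1 : ∀ x → ceilDiv x 1 ≡ x
  ceilDiv-1 x = trans (cong (λ y → ceilDiv y 1) (sym (*-identityʳ x))) (ceilDiv-exact x 1)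
  m+n≤q : m + n ≤ q
  m+n≤q = subst (_≤ q) (cong₂ _+_ (ceilDiv-1 m) (ceilDiv-1 n)) q≥
  n≤q∸m : n ≤ q ∸ m
  n≤q∸m = m+n≤o⇒m≤o∸n n (subst (_≤ q) (+-comm m n) m+n≤q)
  *0≤ : ∀ k {x} → k * 0 ≤ x
  *0≤ k {x} = subst (_≤ x) (sym (*-zeroʳ k)) z≤n

near-bounds : ∀ {x k} t .{{_ : NonZero t}} → ceilDiv x (suc t) ≤ k → k ≤ floorDiv x t → k * t ≤ x × x ≤ k * suc t
near-bounds {x} {k} t ⌈x/t+1⌉≤k k≤⌊x/t⌋ =
  ≤-trans (*-monoˡ-≤ t k≤⌊x/t⌋) (floorDiv-*-≤ x t) ,
  ≤-trans (≤-ceilDiv-* x (suc t)) (*-monoˡ-≤ (suc t) ⌈x/t+1⌉≤k)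

-- Between ⌈m/(t+1)⌉ + ⌈n/(t+1)⌉ and ⌊m/t⌋ + ⌊n/t⌋ classes, X and Y can be split separately into parts of
-- size t or t + 1; the only new value of q not covered by either this or ceilSum m n t is the one in `top`.
allFrom-step : ∀ {m n} t .{{_ : NonZero t}} → AllFrom (K m n) 1 (ceilSum m n t) →
  m ≤ floorDiv m t * suc t → n ≤ floorDiv n t * suc t →
  HasEqTreeColoring (K m n) (suc (floorDiv m t + floorDiv n t)) 1 →
  AllFrom (K m n) 1 (ceilSum m n (suc t))
allFrom-step {m} {n} t prev m≤ n≤ top q q≥ with ceilSum m n t ≤? q | q ≤? floorDiv m t + floorDiv n t
... | yes q≥prev | _  = prev q q≥prev
... | no  q≱prev | no q≰A+B = subst (λ q → HasEqTreeColoring (K m n) q 1) (sym q≡) top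
  where
  q≤ : q ≤ suc (floorDiv m t + floorDiv n t)
  q≤ = ≤-pred (≤-trans (≰⇒> q≱prev) (≤-trans (+-mono-≤ (ceilDiv≤suc-floorDiv m t) (ceilDiv≤suc-floorDiv n t))
         (≤-reflexive (cong suc (+-suc (floorDiv m t) (floorDiv n t))))))
  q≡ : q ≡ suc (floorDiv m t + floorDiv n t)
  q≡ = ≤-antisym q≤ (≰⇒> q≰A+B)
... | no  _ | yes q≤A+B
  with split-between (ceilDiv-least _ (suc t) m≤) (ceilDiv-least _ (suc t) n≤) q≥ q≤A+B
...   | kx , ky , k≡q , kx≥ , kx≤ , ky≥ , ky≤ =
  near-coloring t {kx} {ky} [] [] [] (proj₁ x-bounds) (proj₂ x-bounds) (proj₁ y-bounds) (proj₂ y-bounds) refl refl k≡q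
  where
  x-bounds : kx * t ≤ m × m ≤ kx * suc t
  x-bounds = near-bounds t kx≥ kx≤
  y-bounds : ky * t ≤ n × n ≤ ky * suc t
  y-bounds = near-bounds t ky≥ ky≤

DCond₂ : ℕ → ℕ → ℕ → Set
DCond₂ m n d = (¬ d ∣ m × ¬ d ∣ n) ⊎ (suc d * floorDiv m d < m) ⊎ (suc d * floorDiv n d < n)

dcond₂? : ∀ m n d → Dec (DCond₂ m n d)
dcond₂? m n d = (¬? (d ∣? m) ×-dec ¬? (d ∣? n)) ⊎-dec (suc d * floorDiv m d <? m) ⊎-dec (suc d * floorDiv n d <? n)

DCond₂⇔DCond : ∀ {m n d} → DCond₂ m n d ⇔ DCond (m ∷ n ∷ []) d
DCond₂⇔DCond = mk⇔ to from
  where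
  to : ∀ {m n d} → DCond₂ m n d → DCond (m ∷ n ∷ []) d
  to (inj₁ (d∤m , d∤n))  = inj₁ (zero , suc zero , (λ ()) , d∤m , d∤n)
  to (inj₂ (inj₁ gap))   = inj₂ (zero , gap)
  to (inj₂ (inj₂ gap))   = inj₂ (suc zero , gap)
  from : ∀ {m n d} → DCond (m ∷ n ∷ []) d → DCond₂ m n d
  from (inj₁ (zero     , zero     , i≢j , _))         = ⊥-elim (i≢j refl)
  from (inj₁ (zero     , suc zero , _   , d∤m , d∤n)) = inj₁ (d∤m , d∤n)
  from (inj₁ (suc zero , zero     , _   , d∤n , d∤m)) = inj₁ (d∤m , d∤n)
  from (inj₁ (suc zero , suc zero , i≢j , _))         = ⊥-elim (i≢j refl)
  from (inj₂ (zero     , gap))                        = inj₂ (inj₁ gap)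
  from (inj₂ (suc zero , gap))                        = inj₂ (inj₂ gap)

DCond₂-large : ∀ {m n d} → 1 ≤ m → m < d → DCond₂ m n d
DCond₂-large {m} {n} {d@(suc _)} m≥1 m<d = inj₂ (inj₁ (begin-strict
  suc d * floorDiv m d ≡⟨ cong (suc d *_) (m<n⇒m/n≡0 m<d) ⟩
  suc d * 0            ≡⟨ *-zeroʳ (suc d) ⟩
  0                    <⟨ m≥1 ⟩
  m                    ∎))
  where open ≤-Reasoning

top-of-divisible : ∀ {m n} t .{{_ : NonZero t}} → t ∣ m ⊎ t ∣ n → AllFrom (K m n) 1 (ceilSum m n t) →
  HasEqTreeColoring (K m n) (suc (floorDiv m t + floorDiv n t)) 1
top-of-divisible {m} {n} t (inj₁ t∣m) prev = prev _
  (≤-trans (+-mono-≤ (∣⇒ceilDiv≤floorDiv t t∣m) (ceilDiv≤suc-floorDiv n t)) (≤-reflexive (+-suc _ _)))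
top-of-divisible {m} {n} t (inj₂ t∣n) prev = prev _
  (+-mono-≤ (ceilDiv≤suc-floorDiv m t) (∣⇒ceilDiv≤floorDiv t t∣n))

allFrom-step-¬D : ∀ {m n} t .{{_ : NonZero t}} → ¬ DCond₂ m n t →
  AllFrom (K m n) 1 (ceilSum m n t) → AllFrom (K m n) 1 (ceilSum m n (suc t))
allFrom-step-¬D {m} {n} t ¬D prev =
  allFrom-step t prev (no-gap (¬D ∘ inj₂ ∘ inj₁)) (no-gap (¬D ∘ inj₂ ∘ inj₂)) (top-of-divisible t divisible prev)
  where
  no-gap : ∀ {x} → ¬ suc t * floorDiv x t < x → x ≤ floorDiv x t * suc t
  no-gap {x} ¬gap = subst (x ≤_) (*-comm (suc t) _) (≮⇒≥ ¬gap)
  divisible : t ∣ m ⊎ t ∣ n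
  divisible with t ∣? m | t ∣? n
  ... | yes t∣m | _       = inj₁ t∣m
  ... | no  _   | yes t∣n = inj₂ t∣n
  ... | no  t∤m | no  t∤n = ⊥-elim (¬D (inj₁ (t∤m , t∤n)))

allFrom-climb : ∀ {m n h d} .{{_ : NonZero h}} → h ≤′ d → (∀ t → h ≤ t → t < d → ¬ DCond₂ m n t) →
  AllFrom (K m n) 1 (ceilSum m n h) → AllFrom (K m n) 1 (ceilSum m n d)
allFrom-climb ≤′-refl _ prev = prev
allFrom-climb {h = h} {suc d} (≤′-step h≤′d) ¬D prev =
  allFrom-step-¬D d {{>-nonZero (≤-trans (>-nonZero⁻¹ h) (≤′⇒≤ h≤′d))}} (¬D d (≤′⇒≤ h≤′d) ≤-refl)
    (allFrom-climb h≤′d (λ t h≤t t<d → ¬D t h≤t (m≤n⇒m≤1+n t<d)) prev)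

allFrom-2 : ∀ m n → AllFrom (K m n) 1 (ceilSum m n 2)
allFrom-2 m n = allFrom-step-¬D 1 ¬D₁ (allFrom-1 m n)
  where
  no-gap : ∀ x → ¬ 2 * floorDiv x 1 < x
  no-gap x = ≤⇒≯ (subst (λ y → x ≤ 2 * y) (sym (n/1≡n x)) (m≤m+n x (x + 0)))
  ¬D₁ : ¬ DCond₂ m n 1
  ¬D₁ (inj₁ (1∤m , _)) = 1∤m (1∣ m)
  ¬D₁ (inj₂ (inj₁ gap)) = no-gap m gap
  ¬D₁ (inj₂ (inj₂ gap)) = no-gap n gap

-- For odd m and n the top value q = ⌊m/2⌋ + ⌊n/2⌋ + 1 needs one mixed class K 1 1 beside the pairs.
allFrom-3 : ∀ {m n} → 2 ≤ m → 2 ≤ n → AllFrom (K m n) 1 (ceilSum m n 3)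
allFrom-3 {m} {n} 2≤m 2≤n = allFrom-step 2 (allFrom-2 m n) (≤⌊/2⌋*3 2≤m) (≤⌊/2⌋*3 2≤n) top
  where
  ≤1+⌊/2⌋*2 : ∀ x → x ≤ suc (floorDiv x 2 * 2)
  ≤1+⌊/2⌋*2 x = ≤-pred (<-suc-floorDiv-* x 2)
  ≤⌊/2⌋*3 : ∀ {x} → 2 ≤ x → x ≤ floorDiv x 2 * 3
  ≤⌊/2⌋*3 {x} 2≤x = ≤-trans (≤1+⌊/2⌋*2 x) (≤-trans (+-monoˡ-≤ _ (floorDiv-greatest 1 2 2≤x))
                      (≤-reflexive (sym (*-suc (floorDiv x 2) 2))))
  odd : ∀ {x} → ¬ 2 ∣ x → suc (floorDiv x 2 * 2) ≡ x
  odd {x} 2∤x = ≤-antisym (≤∧≢⇒< (floorDiv-*-≤ x 2) (λ eq → 2∤x (divides (floorDiv x 2) (sym eq)))) (≤1+⌊/2⌋*2 x)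
  top : HasEqTreeColoring (K m n) (suc (floorDiv m 2 + floorDiv n 2)) 1
  top with 2 ∣? m | 2 ∣? n
  ... | yes 2∣m | _       = top-of-divisible 2 (inj₁ 2∣m) (allFrom-2 m n)
  ... | no  _   | yes 2∣n = top-of-divisible 2 (inj₂ 2∣n) (allFrom-2 m n)
  ... | no  2∤m | no  2∤n =
    near-coloring 2 {floorDiv m 2} {floorDiv n 2} ((1 , 1) ∷ []) (inj₁ refl ∷ []) ((inj₂ ≤-refl , inj₂ ≤-refl) ∷ [])
    ≤-refl (*-monoʳ-≤ (floorDiv m 2) (n≤1+n 2)) ≤-refl (*-monoʳ-≤ (floorDiv n 2) (n≤1+n 2))
    (odd 2∤m) (odd 2∤n) refl

-- Lower bounds

no-coloring-0 : ∀ {G r} → 0 < N G → ¬ HasEqTreeColoring G 0 r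
no-coloring-0 0<N (c , _) = case c (fromℕ< 0<N) of λ ()

arboricity-intro : ∀ G {r p} → AllFrom G r p → (∀ q → suc q ≡ p → ¬ HasEqTreeColoring G q r) →
  IsStrongEqVertexArboricity G r p
arboricity-intro G {p = zero}  allFrom _    = allFrom , λ _ _ → z≤n
arboricity-intro G {p = suc q} allFrom none =
  allFrom , λ p′ allFrom′ → ≮⇒≥ λ p′<p → none q refl (allFrom′ q (≤-pred p′<p))

least-≥ : (P : ℕ → Set) → (∀ d → Dec (P d)) → ∀ h k → P (h + k) →
  ∃ λ d → h ≤ d × P d × (∀ d′ → h ≤ d′ → P d′ → d ≤ d′)
least-≥ P P? h zero    Ph = h , ≤-refl , subst P (+-identityʳ h) Ph , λ _ h≤d′ _ → h≤d′
least-≥ P P? h (suc k) Ph+k+1 with P? h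
... | yes Ph = h , ≤-refl , Ph , λ _ h≤d′ _ → h≤d′
... | no ¬Ph with least-≥ P P? (suc h) k (subst P (+-suc h k) Ph+k+1)
...   | d , h<d , Pd , least = d , <⇒≤ h<d , Pd , λ d′ h≤d′ Pd′ →
          least d′ (≤∧≢⇒< h≤d′ λ { refl → ¬Ph Pd′ }) Pd′

pure : ∀ p → MaxDeg≤1 p → 3 ≤ size p → proj₁ p ≡ 0 ⊎ proj₂ p ≡ 0
pure p (inj₁ a≡0 , _)         _    = inj₁ a≡0
pure p (inj₂ _   , inj₁ b≡0)   _    = inj₂ b≡0
pure p (inj₂ b≤1 , inj₂ a≤1) 3≤a+b = ⊥-elim (<⇒≱ (s≤s (+-mono-≤ a≤1 b≤1)) 3≤a+b)

PureCover : (lo hi m n q : ℕ) → Set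
PureCover lo hi m n q = ∃₂ λ kx ky → kx + ky ≡ q × kx * lo ≤ m × m ≤ kx * hi × ky * lo ≤ n × n ≤ ky * hi

module _ {lo hi : ℕ} (3≤lo : 3 ≤ lo) (lo≤hi : lo ≤ hi) where

  private
    lo≤size : ∀ {s} → s ≡ lo ⊎ s ≡ hi → lo ≤ s
    lo≤size (inj₁ refl) = ≤-refl
    lo≤size (inj₂ refl) = lo≤hi

    size≤hi : ∀ {s} → s ≡ lo ⊎ s ≡ hi → s ≤ hi
    size≤hi (inj₁ refl) = lo≤hi
    size≤hi (inj₂ refl) = ≤-refl

  pureCover : ∀ ℓ → All (λ p → size p ≡ lo ⊎ size p ≡ hi) ℓ → All MaxDeg≤1 ℓ →
    PureCover lo hi (sum (map proj₁ ℓ)) (sum (map proj₂ ℓ)) (length ℓ)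
  pureCover [] [] [] = 0 , 0 , refl , z≤n , z≤n , z≤n , z≤n
  pureCover ((a , b) ∷ ℓ) (sized ∷ sizes) (maxDeg ∷ maxDegs)
    with pure (a , b) maxDeg (≤-trans 3≤lo (lo≤size sized)) | pureCover ℓ sizes maxDegs
  ... | inj₁ refl | kx , ky , k≡ , x-lo , x-hi , y-lo , y-hi =
    kx , suc ky , trans (+-suc kx ky) (cong suc k≡) , x-lo , x-hi ,
    +-mono-≤ (lo≤size sized) y-lo , +-mono-≤ (size≤hi sized) y-hi
  ... | inj₂ refl | kx , ky , k≡ , x-lo , x-hi , y-lo , y-hi =
    suc kx , ky , cong suc k≡ ,
    +-mono-≤ (subst (lo ≤_) (+-identityʳ a) (lo≤size sized)) x-lo ,
    +-mono-≤ (subst (_≤ hi) (+-identityʳ a) (size≤hi sized)) x-hi , y-lo , y-hi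

coloring⇒pureCover : ∀ {m n q} → 3 ≤ floorDiv (m + n) q → HasEqTreeColoring (K m n) q 1 →
  PureCover (floorDiv (m + n) q) (ceilDiv (m + n) q) m n q
coloring⇒pureCover {m} {n} {q} 3≤lo coloring with coloring⇒plan {m} {n} {q} coloring
... | record { classes = ℓ ; length≡q = refl ; sumX≡m = refl ; sumY≡n = refl ; equitable = eq ; maxDeg≤1 = md } =
  pureCover 3≤lo (floorDiv≤ceilDiv (m + n) q) ℓ eq md

module _ {m n d q : ℕ} .{{_ : NonZero d}} (m≥1 : 1 ≤ m) (n≥1 : 1 ≤ n) (q+1≡ : suc q ≡ ceilSum m n d) where

  private
    both-short : ∀ {kx ky} → kx + ky ≡ q → kx < ceilDiv m d → ky < ceilDiv n d → ⊥
    both-short {kx} {ky} k≡q kx< ky< = <-irrefl refl (begin-strict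
      suc q                ≡⟨ cong suc k≡q ⟨
      suc (kx + ky)        <⟨ n<1+n _ ⟩
      suc (suc (kx + ky))  ≡⟨ cong suc (+-suc kx ky) ⟨
      suc kx + suc ky      ≤⟨ +-mono-≤ kx< ky< ⟩
      ceilSum m n d        ≡⟨ q+1≡ ⟨
      suc q                ∎)
      where open ≤-Reasoning

  -- Minimality of d against the q = ⌈m/d⌉ + ⌈n/d⌉ − 1 pure classes: if their sizes lie below d the classes
  -- are too few, above d too large, and at size d condition (i) or (ii) rules them out.
  ¬pureCover : ∀ {lo hi} → DCond₂ m n d → hi ≤ suc lo → ¬ PureCover lo hi m n q
  ¬pureCover {lo} {hi} D hi≤1+lo (kx , ky , k≡q , x-lo , x-hi , y-lo , y-hi) with <-cmp lo d
  ... | tri< lo<d _ _ = <-irrefl refl (begin-strict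
        q               <⟨ n<1+n q ⟩
        suc q           ≡⟨ q+1≡ ⟩
        ceilSum m n d   ≤⟨ +-mono-≤ (ceilDiv-least kx d (≤-trans x-hi (*-monoʳ-≤ kx hi≤d)))
                                    (ceilDiv-least ky d (≤-trans y-hi (*-monoʳ-≤ ky hi≤d))) ⟩
        kx + ky         ≡⟨ k≡q ⟩
        q               ∎)
    where
    open ≤-Reasoning
    hi≤d : hi ≤ d
    hi≤d = ≤-trans hi≤1+lo lo<d
  ... | tri> _ _ d<lo = both-short k≡q (*-<⇒<-ceilDiv kx d (*-suc-≤⇒*-< {k = kx} {d} m≥1 (≤-trans (*-monoʳ-≤ kx d<lo) x-lo)))
                                       (*-<⇒<-ceilDiv ky d (*-suc-≤⇒*-< {k = ky} {d} n≥1 (≤-trans (*-monoʳ-≤ ky d<lo) y-lo)))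
  ... | tri≈ _ refl _ with D
  ...   | inj₁ (d∤m , d∤n) = both-short k≡q (*-<⇒<-ceilDiv kx d (≤∧≢⇒< x-lo λ eq → d∤m (divides kx (sym eq))))
                                            (*-<⇒<-ceilDiv ky d (≤∧≢⇒< y-lo λ eq → d∤n (divides ky (sym eq))))
  ...   | inj₂ (inj₁ gap) = <⇒≱ gap (≤-trans x-hi (≤-trans (*-monoʳ-≤ kx hi≤1+lo)
                              (≤-trans (*-monoˡ-≤ (suc d) (floorDiv-greatest kx d x-lo)) (≤-reflexive (*-comm _ (suc d))))))
  ...   | inj₂ (inj₂ gap) = <⇒≱ gap (≤-trans y-hi (≤-trans (*-monoʳ-≤ ky hi≤1+lo)
                              (≤-trans (*-monoˡ-≤ (suc d) (floorDiv-greatest ky d y-lo)) (≤-reflexive (*-comm _ (suc d))))))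

-- d is the least DCond₂-value above h, so the colourings reach from ⌈m/h⌉ + ⌈n/h⌉ up to ⌈m/d⌉ + ⌈n/d⌉; one class
-- fewer forces classes of size at least 3, which are pure.
arboricity-p : ∀ {m n} q₀ h .{{_ : NonZero h}} → 1 ≤ m → 1 ≤ n → ceilDiv (m + n) q₀ ≡ h →
  AllFrom (K m n) 1 (ceilSum m n h) → 3 * ceilSum m n h ≤ m + n + 3 →
  ∃ λ v → IsP q₀ (m ∷ n ∷ []) v × IsStrongEqVertexArboricity (K m n) 1 v
arboricity-p {m} {n} q₀ h m≥1 n≥1 ⌈N/q₀⌉≡h allFrom-h bound
  with least-≥ (DCond₂ m n) (dcond₂? m n) h (suc m)
              (subst (DCond₂ m n) (sym (+-suc h m)) (DCond₂-large m≥1 (s≤s (m≤n+m m h))))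
... | d , h≤d , D , least =
  ceilSum m n d , p-value , arboricity-intro (K m n) (allFrom-climb (≤⇒≤′ h≤d) no-D-before allFrom-h) none
  where
  instance
    d≢0 : NonZero d
    d≢0 = >-nonZero (≤-trans (>-nonZero⁻¹ h) h≤d)
  h≡ : ceilDiv (sumV (m ∷ n ∷ [])) q₀ ≡ h
  h≡ = trans (cong (λ x → ceilDiv (m + x) q₀) (+-identityʳ n)) ⌈N/q₀⌉≡h
  p-value : IsP q₀ (m ∷ n ∷ []) (ceilSum m n d)
  p-value = d , (subst (_≤ d) (sym h≡) h≤d , Equivalence.to DCond₂⇔DCond D ,
                 λ d′ h≤d′ D′ → least d′ (subst (_≤ d′) h≡ h≤d′) (Equivalence.from DCond₂⇔DCond D′)) ,
            cong (ceilDiv m d +_) (sym (+-identityʳ _))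
  no-D-before : ∀ t → h ≤ t → t < d → ¬ DCond₂ m n t
  no-D-before t h≤t t<d Dt = <⇒≱ t<d (least t h≤t Dt)
  none : ∀ q → suc q ≡ ceilSum m n d → ¬ HasEqTreeColoring (K m n) q 1
  none zero      _     = no-coloring-0 {K m n} (≤-trans m≥1 (m≤m+n m n))
  none q@(suc _) q+1≡ coloring =
    ¬pureCover m≥1 n≥1 q+1≡ D (ceilDiv≤suc-floorDiv (m + n) q) (coloring⇒pureCover (floorDiv-greatest 3 q 3q≤N) coloring)
    where
    open ≤-Reasoning
    3q≤N : 3 * q ≤ m + n
    3q≤N = +-cancelʳ-≤ 3 _ _ (begin
      3 * q + 3         ≡⟨ +-comm (3 * q) 3 ⟩
      3 + 3 * q         ≡⟨ *-suc 3 q ⟨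
      3 * suc q         ≡⟨ cong (3 *_) q+1≡ ⟩
      3 * ceilSum m n d ≤⟨ *-monoʳ-≤ 3 (+-mono-≤ (ceilDiv-antitone m {h} {d} h≤d) (ceilDiv-antitone n {h} {d} h≤d)) ⟩
      3 * ceilSum m n h ≤⟨ bound ⟩
      m + n + 3         ∎)

-- For m ≤ 2 a class of size at least 3 cannot meet X, so q ≥ ⌈(m + n + 1)/3⌉ is necessary; below ⌈m/2⌉ + ⌈n/2⌉
-- the class K m r of size 2 is combined with classes of size 2 or 3 inside Y.
module _ {m n r : ℕ} (m+r≡2 : m + r ≡ 2) (m≥1 : 1 ≤ m) (n≥1 : 1 ≤ n) (maxDeg : MaxDeg≤1 (m , r)) where

  private
    r≤1 : r ≤ 1
    r≤1 = +-cancelˡ-≤ m r 1 (≤-trans (≤-reflexive m+r≡2) (+-monoˡ-≤ 1 m≥1))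
    m≤2 : m ≤ 2
    m≤2 = subst (m ≤_) m+r≡2 (m≤m+n m r)
    N+1≡ : n + (m + 1) ≡ suc (m + n)
    N+1≡ = trans (+-comm n (m + 1)) (trans (+-assoc m 1 n) (+-suc m n))

    mixed-coloring : ∀ q → 1 ≤ q → q ≤ ceilDiv n 2 → ceilDiv (n + (m + 1)) 3 ≤ q → HasEqTreeColoring (K m n) q 1
    mixed-coloring (suc k) _ k<⌈n/2⌉ q≥ = near-coloring 2 {0} {k} {0} {n ∸ r} ((m , r) ∷ []) (inj₁ m+r≡2 ∷ []) (maxDeg ∷ [])
      z≤n z≤n y-lo y-hi (trans (+-identityʳ _) (+-identityʳ m))
      (trans (cong (_+ (n ∸ r)) (+-identityʳ r)) (m+[n∸m]≡n (≤-trans r≤1 n≥1))) refl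
      where
      open ≤-Reasoning
      y-lo : k * 2 ≤ n ∸ r
      y-lo = m+n≤o⇒m≤o∸n (k * 2) (≤-trans (+-monoʳ-≤ (k * 2) r≤1) (subst (_≤ n) (+-comm 1 (k * 2)) (<-ceilDiv⇒*-< 2 k<⌈n/2⌉)))
      y-hi : n ∸ r ≤ k * 3
      y-hi = m≤n+o⇒m∸n≤o n r (+-cancelˡ-≤ (m + 1) n (r + k * 3) (begin
        m + 1 + n             ≡⟨ +-comm (m + 1) n ⟩
        n + (m + 1)           ≤⟨ ≤-ceilDiv-* _ 3 ⟩
        ceilDiv (n + (m + 1)) 3 * 3 ≤⟨ *-monoˡ-≤ 3 q≥ ⟩
        3 + k * 3             ≡⟨ cong (λ s → suc s + k * 3) m+r≡2 ⟨
        suc (m + r) + k * 3   ≡⟨ cong (λ s → s + k * 3) (trans (+-assoc m 1 r) (+-suc m r)) ⟨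
        m + 1 + r + k * 3     ≡⟨ +-assoc (m + 1) r (k * 3) ⟩
        m + 1 + (r + k * 3)   ∎))

    no-pureCover : ∀ {lo hi q} → 3 ≤ lo → ¬ PureCover lo hi m n q
    no-pureCover {lo} 3≤lo (zero   , _ , _ , _    , m≤0 , _) = <⇒≱ m≥1 m≤0
    no-pureCover {lo} 3≤lo (suc kx , _ , _ , x-lo , _   , _) = <⇒≱ (s≤s m≤2) (≤-trans 3≤lo (m+n≤o⇒m≤o lo x-lo))

  allFrom-small : AllFrom (K m n) 1 (ceilDiv (n + (m + 1)) 3)
  allFrom-small q q≥ with ceilSum m n 2 ≤? q
  ... | yes q≥ceilSum = allFrom-2 m n q q≥ceilSum
  ... | no  q≱ceilSum = mixed-coloring q (≤-trans (*-<⇒<-ceilDiv 0 3 (subst (0 <_) (sym N+1≡) (s≤s z≤n))) q≥)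
    (≤-pred (subst (λ c → q < c + ceilDiv n 2) (ceilDiv-unique 0 2 m≥1 m≤2) (≰⇒> q≱ceilSum))) q≥

  no-coloring-small : ∀ q → suc q ≡ ceilDiv (n + (m + 1)) 3 → ¬ HasEqTreeColoring (K m n) q 1
  no-coloring-small zero      _    = no-coloring-0 {K m n} (≤-trans m≥1 (m≤m+n m n))
  no-coloring-small q@(suc _) q+1≡ coloring =
    no-pureCover (floorDiv-greatest 3 q 3q≤N) (coloring⇒pureCover (floorDiv-greatest 3 q 3q≤N) coloring)
    where
    3q≤N : 3 * q ≤ m + n
    3q≤N = ≤-pred (subst₂ _<_ (*-comm q 3) N+1≡ (<-ceilDiv⇒*-< 3 (subst (q <_) q+1≡ (n<1+n q))))

arboricity-small : ∀ {m n r} → m + r ≡ 2 → 1 ≤ m → 1 ≤ n → MaxDeg≤1 (m , r) →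
  IsStrongEqVertexArboricity (K m n) 1 (ceilDiv (n + (m + 1)) 3)
arboricity-small {m} {n} m+r≡2 m≥1 n≥1 maxDeg =
  arboricity-intro (K m n) (allFrom-small m+r≡2 m≥1 n≥1 maxDeg) (no-coloring-small m+r≡2 m≥1 n≥1 maxDeg)

-- Pure classes of size at least 3 fit at most B times into m < 3(B + 1) and C times into n < 3(C + 1).
arboricity-B+C+2 : ∀ {m n} B C → 2 ≤ m → 2 ≤ n → m < suc B * 3 → n < suc C * 3 → 3 * suc (B + C) ≤ m + n →
  IsStrongEqVertexArboricity (K m n) 1 (B + C + 2)
arboricity-B+C+2 {m} {n} B C 2≤m 2≤n m< n< 3q≤N = arboricity-intro (K m n) allFrom none
  where
  B+C+2≡ : B + C + 2 ≡ suc (suc (B + C))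
  B+C+2≡ = +-comm (B + C) 2
  allFrom : AllFrom (K m n) 1 (B + C + 2)
  allFrom q q≥ = allFrom-3 2≤m 2≤n q (≤-trans
    (+-mono-≤ (ceilDiv-least (suc B) 3 (<⇒≤ m<)) (ceilDiv-least (suc C) 3 (<⇒≤ n<)))
    (≤-trans (≤-reflexive (trans (cong suc (+-suc B C)) (sym B+C+2≡))) q≥))
  none : ∀ q → suc q ≡ B + C + 2 → ¬ HasEqTreeColoring (K m n) q 1
  none q q+1≡ coloring with suc-injective (trans q+1≡ B+C+2≡)
  ... | refl with coloring⇒pureCover (floorDiv-greatest 3 q 3q≤N) coloring
  ...   | kx , ky , k≡q , x-lo , _ , y-lo , _ =
    <-irrefl k≡q (s≤s (+-mono-≤ (at-most {k = kx} B x-lo m<) (at-most {k = ky} C y-lo n<)))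
    where
    at-most : ∀ {x k} D → k * floorDiv (m + n) q ≤ x → x < suc D * 3 → k ≤ D
    at-most {k = k} D k*lo≤x x< = ≤-pred (*-cancelʳ-< 3 k (suc D)
      (≤-<-trans (≤-trans (*-monoʳ-≤ k (floorDiv-greatest 3 q 3q≤N)) k*lo≤x) x<))

≤-by : ∀ {a b} k → a + k ≡ b → a ≤ b
≤-by {a} k a+k≡b = subst (a ≤_) a+k≡b (m≤m+n a k)

ceilSum-bound : ∀ {m n h} B C .{{_ : NonZero h}} → m ≤ B * h → n ≤ C * h → 3 * (B + C) ≤ m + n + 3 →
  3 * ceilSum m n h ≤ m + n + 3
ceilSum-bound {h = h} B C m≤ n≤ le = ≤-trans (*-monoʳ-≤ 3 (+-mono-≤ (ceilDiv-least B h m≤) (ceilDiv-least C h n≤))) le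

module _ {x : ℕ} where
  open ≤-Reasoning

  3*-+≤*4 : ∀ {r} → r ≤ x → 3 * x + r ≤ x * 4
  3*-+≤*4 {r} r≤x = begin
    3 * x + r   ≤⟨ +-monoʳ-≤ (3 * x) r≤x ⟩
    3 * x + x   ≡⟨ +-comm (3 * x) x ⟩
    4 * x       ≡⟨ *-comm 4 x ⟩
    x * 4       ∎

  floorDiv-3*-+ : ∀ {r} → r < 3 → floorDiv (3 * x + r) 3 ≡ x
  floorDiv-3*-+ {r} r<3 = trans (cong (λ y → floorDiv (y + r) 3) (*-comm 3 x)) (floorDiv-+ x 3 r<3)

3*-≥2 : ∀ {x} → 1 ≤ x → 2 ≤ 3 * x
3*-≥2 x≥1 = ≤-trans (s≤s (s≤s z≤n)) (*-monoʳ-≤ 3 x≥1)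

3*-+-distrib : ∀ b c r s → 3 * b + r + (3 * c + s) ≡ 3 * (b + c) + (r + s)
3*-+-distrib b c r s = trans (+-interchange (3 * b) r (3 * c) s) (cong (_+ (r + s)) (sym (*-distribˡ-+ 3 b c)))

3*-+<suc*3 : ∀ {x r} → r < 3 → 3 * x + r < suc x * 3
3*-+<suc*3 {x} {r} r<3 = subst (3 * x + r <_) (trans (+-comm (3 * x) 3) (cong (3 +_) (*-comm 3 x))) (+-monoʳ-< (3 * x) r<3)

3*suc≤ : ∀ k {r} → 3 ≤ r → 3 * suc k ≤ 3 * k + r
3*suc≤ k 3≤r = ≤-trans (≤-reflexive (trans (*-suc 3 k) (+-comm 3 (3 * k)))) (+-monoʳ-≤ (3 * k) 3≤r)

≤-+3 : ∀ {m n} k r → m + n ≡ k + r → k ≤ m + n + 3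
≤-+3 k r N≡ = ≤-trans (m≤m+n k r) (≤-trans (≤-reflexive (sym N≡)) (m≤m+n _ 3))

arboricity-3b-3c : ∀ {b c} → 1 ≤ b → 1 ≤ c →
  Σ ℕ λ v → IsP (b + c) (3 * b ∷ 3 * c ∷ []) v × IsStrongEqVertexArboricity (K (3 * b) (3 * c)) 1 v
arboricity-3b-3c {b@(suc _)} {c@(suc _)} b≥1 c≥1 =
  arboricity-p (b + c) 3 (≤-trans b≥1 (m≤n*m b 3)) (≤-trans c≥1 (m≤n*m c 3))
    (trans (cong (λ N → ceilDiv N (b + c)) (sym (*-distribˡ-+ 3 b c))) (ceilDiv-exact 3 (b + c)))
    (allFrom-3 (3*-≥2 b≥1) (3*-≥2 c≥1))
    (ceilSum-bound b c (≤-reflexive (*-comm 3 b)) (≤-reflexive (*-comm 3 c))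
      (≤-+3 {3 * b} {3 * c} (3 * (b + c)) 0 (trans (sym (*-distribˡ-+ 3 b c)) (sym (+-identityʳ _)))))

arboricity-3b-3c+1 : ∀ {b c} → 1 ≤ b → 1 ≤ c →
  Σ ℕ λ v → IsP (b + c) (3 * b ∷ 3 * c + 1 ∷ []) v × IsStrongEqVertexArboricity (K (3 * b) (3 * c + 1)) 1 v
arboricity-3b-3c+1 {b@(suc _)} {c@(suc _)} b≥1 c≥1 =
  arboricity-p (b + c) 4 (≤-trans b≥1 (m≤n*m b 3)) (m≤n+m 1 (3 * c))
    (trans (cong (λ N → ceilDiv N (b + c)) N≡) (ceilDiv-+ 3 (b + c) (s≤s z≤n) (≤-trans b≥1 (m≤m+n b c))))
    (allFrom-step 3 allFrom-3′ (subst (λ k → m ≤ k * 4) (sym ⌊m/3⌋≡b) m≤b*4) (subst (λ k → n ≤ k * 4) (sym ⌊n/3⌋≡c) n≤c*4)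
      (top-of-divisible 3 (inj₁ (divides b (*-comm 3 b))) allFrom-3′))
    (ceilSum-bound b c m≤b*4 n≤c*4 (≤-+3 {m} {n} (3 * (b + c)) 1 N≡))
  where
  m n : ℕ
  m = 3 * b
  n = 3 * c + 1
  N≡ : m + n ≡ 3 * (b + c) + 1
  N≡ = trans (cong (_+ n) (sym (+-identityʳ m))) (3*-+-distrib b c 0 1)
  ⌊m/3⌋≡b : floorDiv m 3 ≡ b
  ⌊m/3⌋≡b = trans (cong (λ y → floorDiv y 3) (sym (+-identityʳ m))) (floorDiv-3*-+ (s≤s z≤n))
  ⌊n/3⌋≡c : floorDiv n 3 ≡ c
  ⌊n/3⌋≡c = floorDiv-3*-+ (s≤s (s≤s z≤n))
  m≤b*4 : m ≤ b * 4
  m≤b*4 = subst (_≤ b * 4) (+-identityʳ m) (3*-+≤*4 z≤n)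
  n≤c*4 : n ≤ c * 4
  n≤c*4 = 3*-+≤*4 c≥1
  allFrom-3′ : AllFrom (K m n) 1 (ceilSum m n 3)
  allFrom-3′ = allFrom-3 (3*-≥2 b≥1) (≤-trans (3*-≥2 c≥1) (m≤m+n _ 1))

arboricity-3b-3c+2 : ∀ {b c} → 1 ≤ b → 1 ≤ c →
  Σ ℕ λ v → IsP (b + c + 1) (3 * b ∷ 3 * c + 2 ∷ []) v × IsStrongEqVertexArboricity (K (3 * b) (3 * c + 2)) 1 v
arboricity-3b-3c+2 {b@(suc _)} {c@(suc _)} b≥1 c≥1 =
  arboricity-p (b + c + 1) 3 (≤-trans b≥1 (m≤n*m b 3)) (≤-trans (s≤s z≤n) (m≤n+m 2 (3 * c)))
    (trans (cong (λ N → ceilDiv N (b + c + 1)) (N≡ b c)) (ceilDiv-+ 2 (b + c + 1) (≤-trans b≥1 (m≤m+n b c)) (m≤m+n (b + c) 1)))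
    (allFrom-3 (3*-≥2 b≥1) (m≤n+m 2 (3 * c)))
    (ceilSum-bound b (suc c) (≤-reflexive (*-comm 3 b)) (<⇒≤ (3*-+<suc*3 (s≤s (s≤s (s≤s z≤n))))) (≤-by 2 (bound≡ b c)))
  where
  N≡ : ∀ b c → 3 * b + (3 * c + 2) ≡ 2 * (b + c + 1) + (b + c)
  N≡ = solve-∀
  bound≡ : ∀ b c → 3 * (b + suc c) + 2 ≡ 3 * b + (3 * c + 2) + 3
  bound≡ = solve-∀

arboricity-3b+1-3c+1 : ∀ {b c} → 1 ≤ b → 1 ≤ c →
  Σ ℕ λ v → IsP (b + c) (3 * b + 1 ∷ 3 * c + 1 ∷ []) v × IsStrongEqVertexArboricity (K (3 * b + 1) (3 * c + 1)) 1 v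
arboricity-3b+1-3c+1 {b@(suc _)} {c@(suc _)} b≥1 c≥1 =
  arboricity-p (b + c) 4 (m≤n+m 1 (3 * b)) (m≤n+m 1 (3 * c))
    (trans (cong (λ N → ceilDiv N (b + c)) N≡) (ceilDiv-+ 3 (b + c) (s≤s z≤n) (+-mono-≤ b≥1 c≥1)))
    (allFrom-step 3 allFrom-3′ (subst (λ k → m ≤ k * 4) (sym ⌊m/3⌋≡b) m≤b*4) (subst (λ k → n ≤ k * 4) (sym ⌊n/3⌋≡c) n≤c*4) top)
    (ceilSum-bound b c m≤b*4 n≤c*4 (≤-+3 {m} {n} (3 * (b + c)) 2 N≡))
  where
  m n : ℕ
  m = 3 * b + 1
  n = 3 * c + 1
  N≡ : m + n ≡ 3 * (b + c) + 2
  N≡ = 3*-+-distrib b c 1 1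
  ⌊m/3⌋≡b : floorDiv m 3 ≡ b
  ⌊m/3⌋≡b = floorDiv-3*-+ (s≤s (s≤s z≤n))
  ⌊n/3⌋≡c : floorDiv n 3 ≡ c
  ⌊n/3⌋≡c = floorDiv-3*-+ (s≤s (s≤s z≤n))
  m≤b*4 : m ≤ b * 4
  m≤b*4 = 3*-+≤*4 b≥1
  n≤c*4 : n ≤ c * 4
  n≤c*4 = 3*-+≤*4 c≥1
  allFrom-3′ : AllFrom (K m n) 1 (ceilSum m n 3)
  allFrom-3′ = allFrom-3 (≤-trans (3*-≥2 b≥1) (m≤m+n _ 1)) (≤-trans (3*-≥2 c≥1) (m≤m+n _ 1))
  pairs : ∀ x → x * 2 ≤ 3 * x
  pairs x = ≤-trans (*-monoʳ-≤ x (n≤1+n 2)) (≤-reflexive (*-comm x 3))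
  -- D holds at 3 (neither m nor n is divisible by 3): the top value needs the mixed class K 1 1.
  top : HasEqTreeColoring (K m n) (suc (floorDiv m 3 + floorDiv n 3)) 1
  top = near-coloring 2 {b} {c} ((1 , 1) ∷ []) (inj₁ refl ∷ []) ((inj₂ ≤-refl , inj₂ ≤-refl) ∷ [])
    (pairs b) (≤-reflexive (*-comm 3 b)) (pairs c) (≤-reflexive (*-comm 3 c))
    (+-comm 1 (3 * b)) (+-comm 1 (3 * c)) (cong suc (sym (cong₂ _+_ ⌊m/3⌋≡b ⌊n/3⌋≡c)))

arboricity-3b+1-3c+2 : ∀ {b c} → 1 ≤ b → 1 ≤ c → IsStrongEqVertexArboricity (K (3 * b + 1) (3 * c + 2)) 1 (b + c + 2)
arboricity-3b+1-3c+2 {b} {c} b≥1 c≥1 = arboricity-B+C+2 b c (≤-trans (3*-≥2 b≥1) (m≤m+n _ 1)) (m≤n+m 2 (3 * c))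
  (3*-+<suc*3 {b} (s≤s (s≤s z≤n))) (3*-+<suc*3 {c} (s≤s (s≤s (s≤s z≤n))))
  (≤-trans (3*suc≤ (b + c) ≤-refl) (≤-reflexive (sym (3*-+-distrib b c 1 2))))

arboricity-3b+2-3c+2 : ∀ {b c} → 1 ≤ b → 1 ≤ c → IsStrongEqVertexArboricity (K (3 * b + 2) (3 * c + 2)) 1 (b + c + 2)
arboricity-3b+2-3c+2 {b} {c} b≥1 c≥1 = arboricity-B+C+2 b c (m≤n+m 2 (3 * b)) (m≤n+m 2 (3 * c))
  (3*-+<suc*3 {b} (s≤s (s≤s (s≤s z≤n)))) (3*-+<suc*3 {c} (s≤s (s≤s (s≤s z≤n))))
  (≤-trans (3*suc≤ (b + c) (n≤1+n 3)) (≤-reflexive (sym (3*-+-distrib b c 2 2))))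

theorem2 : (m n : ℕ) → 1 ≤ m → 1 ≤ n →
      (m ≡ 1 → IsStrongEqVertexArboricity (K m n) 1 (ceilDiv (n + 2) 3))
    × (m ≡ 2 → IsStrongEqVertexArboricity (K m n) 1 (ceilDiv (n + 3) 3))
    × (∀ b c → 1 ≤ b → 1 ≤ c → m ≡ 3 * b → n ≡ 3 * c →
         Σ ℕ λ v → IsP (b + c) (m ∷ n ∷ []) v × IsStrongEqVertexArboricity (K m n) 1 v)
    × (∀ b c → 1 ≤ b → 1 ≤ c → m ≡ 3 * b → n ≡ 3 * c + 1 →
         Σ ℕ λ v → IsP (b + c) (m ∷ n ∷ []) v × IsStrongEqVertexArboricity (K m n) 1 v)
    × (∀ b c → 1 ≤ b → 1 ≤ c → m ≡ 3 * b → n ≡ 3 * c + 2 →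
         Σ ℕ λ v → IsP (b + c + 1) (m ∷ n ∷ []) v × IsStrongEqVertexArboricity (K m n) 1 v)
    × (∀ b c → 1 ≤ b → 1 ≤ c → m ≡ 3 * b + 1 → n ≡ 3 * c + 1 →
         Σ ℕ λ v → IsP (b + c) (m ∷ n ∷ []) v × IsStrongEqVertexArboricity (K m n) 1 v)
    × (∀ b c → 1 ≤ b → 1 ≤ c → m ≡ 3 * b + 1 → n ≡ 3 * c + 2 →
         IsStrongEqVertexArboricity (K m n) 1 (b + c + 2))
    × (∀ b c → 1 ≤ b → 1 ≤ c → m ≡ 3 * b + 2 → n ≡ 3 * c + 2 →
         IsStrongEqVertexArboricity (K m n) 1 (b + c + 2))
theorem2 m n _ n≥1 =
    (λ { refl → arboricity-small {r = 1} refl (s≤s z≤n) n≥1 (inj₂ ≤-refl , inj₂ ≤-refl) })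
  , (λ { refl → arboricity-small {r = 0} refl (s≤s z≤n) n≥1 (inj₂ z≤n , inj₁ refl) })
  , (λ { _ _ b≥1 c≥1 refl refl → arboricity-3b-3c b≥1 c≥1 })
  , (λ { _ _ b≥1 c≥1 refl refl → arboricity-3b-3c+1 b≥1 c≥1 })
  , (λ { _ _ b≥1 c≥1 refl refl → arboricity-3b-3c+2 b≥1 c≥1 })
  , (λ { _ _ b≥1 c≥1 refl refl → arboricity-3b+1-3c+1 b≥1 c≥1 })
  , (λ { _ _ b≥1 c≥1 refl refl → arboricity-3b+1-3c+2 b≥1 c≥1 })
  , (λ { _ _ b≥1 c≥1 refl refl → arboricity-3b+2-3c+2 b≥1 c≥1 })
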